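{- For any two rooted ordered trees $T_1$ and $T_2$, the tree edit distance between $T_1$ and $T_2$ equals the distance $d(\Theta(T_1),\Theta(T_2))$ between the associated one-stack sortable permutations.
   Context: Rooted ordered (plane) trees have the children of each vertex ordered left to right. Tree edit operations (each of cost $1$): deletion of an edge $(p(v),v)$, where $p(v)$ is the parent of $v$, is its contraction: $v$ is merged into $p(v)$ and the children of $v$ replace $v$, in order, in the ordered list of children of $p(v)$; insertion is the converse operation. The tree edit distance is the minimal number of such operations transforming one tree into the other. Permutations are written as words. One-stack sortable permutations: the empty word is one; a permutation $\sigma$ of $\{1,\dots,n\}$, $n\ge1$, is one if $\sigma=I\,n\,J$ for some $0\le p\le n-1$, with $I$ a one-stack sortable permutation of $\{1,\dots,p\}$ and $J$ a word on $\{p+1,\dots,n-1\}$ that becomes one-stack sortable after subtracting $p$ from each letter. For a tree $T$ with $n$ edges, $\Theta(T)$ is obtained by labelling the edges $1,\dots,n$ in postfix depth-first order (children left to right; the edge to $v$ is labelled after all edges below $v$) and reading the labels in prefix depth-first order (the edge to $v$ is read when $v$ is first reached). A factor of $\sigma$ is a word of consecutive letters; it is compact if its letters form an integer interval; a factor $f$ is complete if it is compact and there is no nonempty factor $g$ with $fg$ a factor of $\sigma$ that is compact and has the same largest letter as $f$. For a word $w$ and integer $a$, $\overline{w}^{a}$ is obtained by adding $1$ to each letter $\ge a$. Permutation deletion $(\sigma_k\to\Lambda)$: remove $\sigma_k$ and decrease by $1$ all letters greater than $\sigma_k$. Permutation insertion: $(\Lambda\to\varnothing)$ maps the empty word to $(1)$;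 for $\sigma=ufv$ nonempty with $f$ a complete factor, $(\Lambda\to f)$ gives $\overline{u}^{a}af\overline{v}^{a}$ and $(\Lambda\overset{r}{\to}f)$ gives $\overline{u}^{a}fa\overline{v}^{a}$, with $a=\max f+1$, and $(\Lambda\overset{l}{\to}f)$ gives $\overline{u}^{a}a\overline{f}^{a}\overline{v}^{a}$ with $a=\min f$. The distance $d(\sigma_1,\sigma_2)$ between one-stack sortable permutations is the minimal number of permutation deletions and insertions transforming $\sigma_1$ into $\sigma_2$. -}

module Defs where

open import Data.Nat using (ℕ; zero; suc; _≤_; _⊔_; _⊓_; _≤ᵇ_; _<ᵇ_; pred)
open import Data.Bool using (if_then_else_)
open import Data.List using (List; []; _∷_; _++_; map; foldr)
open import Data.List.Membership.Propositional using (_∈_)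
open import Data.Product using (_×_; _,_; proj₁; Σ)
open import Data.Sum using (_⊎_)
open import Relation.Binary.PropositionalEquality using (_≡_; _≢_)
open import Function.Bundles using (_⇔_)

data Steps {A : Set} (R : A → A → Set) : ℕ → A → A → Set where
  done : ∀ {x} → Steps R 0 x x
  step : ∀ {n x y z} → R x y → Steps R n y z → Steps R (suc n) x z

IsDist : {A : Set} → (A → A → Set) → A → A → ℕ → Set
IsDist R x y n = Steps R n x y × (∀ m → Steps R m x y → n ≤ m)

data Tree : Set where
  node : List Tree → Tree

-- Contraction of one edge (deletion).  Contracting the edge to a child
-- node cs replaces that child by cs, in order, in its parent's list.
mutual
  data DelT : Tree → Tree → Set where
    inside : ∀ {cs cs'} → DelF cs cs' → DelT (node cs) (node cs')

  data DelF : List Tree → List Tree → Set where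
    here  : ∀ cs ts → DelF (node cs ∷ ts) (cs ++ ts)
    deep  : ∀ {t t'} ts → DelT t t' → DelF (t ∷ ts) (t' ∷ ts)
    later : ∀ t {ts ts'} → DelF ts ts' → DelF (t ∷ ts) (t ∷ ts')

TreeEdit : Tree → Tree → Set
TreeEdit T T' = DelT T T' ⊎ DelT T' T

TreeEditDist : Tree → Tree → ℕ → Set
TreeEditDist = IsDist TreeEdit

-- Θ : postfix labelling of edges, read in prefix order.
-- thetaF s ts : s = number of labels already used; returns the word read
-- in prefix order and the new number of used labels.

thetaF : ℕ → List Tree → Σ (List ℕ) (λ _ → ℕ)
thetaF s [] = [] , s
thetaF s (node cs ∷ ts) with thetaF s cs
... | w , s' with thetaF (suc s') ts
... | w₂ , s'' = (suc s' ∷ w ++ w₂) , s''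

Θ : Tree → List ℕ
Θ (node cs) = proj₁ (thetaF 0 cs)

maxL : List ℕ → ℕ
maxL = foldr _⊔_ 0

minL : List ℕ → ℕ
minL []       = 0
minL (x ∷ xs) = foldr _⊓_ x xs

Compact : List ℕ → Set
Compact f = f ≢ [] × (∀ x → x ∈ f ⇔ (minL f ≤ x × x ≤ maxL f))

-- f is a complete factor of u f v
Complete : List ℕ → List ℕ → Set
Complete f v = Compact f ×
  (∀ g w → v ≡ g ++ w → g ≢ [] → Compact (f ++ g) → maxL (f ++ g) ≢ maxL f)

bump : ℕ → List ℕ → List ℕ
bump a = map (λ x → if a ≤ᵇ x then suc x else x)

unbump : ℕ → List ℕ → List ℕ
unbump b = map (λ x → if b <ᵇ x then pred x else x)

data PermDel : List ℕ → List ℕ → Set where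
  del : ∀ u x v → PermDel (u ++ x ∷ v) (unbump x u ++ unbump x v)

data PermIns : List ℕ → List ℕ → Set where
  insEmpty : PermIns [] (1 ∷ [])
  ins  : ∀ u f v → Complete f v →
         PermIns (u ++ f ++ v)
                 (bump (suc (maxL f)) u ++ suc (maxL f) ∷ f ++ bump (suc (maxL f)) v)
  insR : ∀ u f v → Complete f v →
         PermIns (u ++ f ++ v)
                 (bump (suc (maxL f)) u ++ f ++ suc (maxL f) ∷ bump (suc (maxL f)) v)
  insL : ∀ u f v → Complete f v →
         PermIns (u ++ f ++ v)
                 (bump (minL f) u ++ minL f ∷ bump (minL f) f ++ bump (minL f) v)

PermEdit : List ℕ → List ℕ → Set
PermEdit σ τ = PermDel σ τ ⊎ PermIns σ τ

PermDist : List ℕ → List ℕ → ℕ → Set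
PermDist = IsDist PermEdit

{-# OPTIONS --safe #-}
module Submission where

-- Contracting an edge deletes its label from the word and renumbers the larger labels.  Inserting an
-- edge is one of the three permutation insertions around the word f of a run of consecutive sibling
-- subtrees: the new edge becomes their parent (Λ → f), or a new leaf to their left (Λ →l f) or right
-- (Λ →r f); such an f is a complete factor.  Conversely every letter of Θ T labels an edge, and every
-- complete factor of Θ T is the word of such a run: by maximality it cannot end inside a subtree, and
-- by compactness it cannot straddle a root label.  So every permutation edit of Θ T comes from a tree
-- edit, and since Θ is injective, edit paths of trees and of their words correspond step by step.

open import Defs
open import Data.Nat using (ℕ; suc; _+_; _≤_; _<_; _⊔_; _⊓_; _≤ᵇ_; _<ᵇ_; pred; z≤n; s≤s)
open import Data.Nat.Properties
open import Data.Bool using (true; false; if_then_else_)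
open import Data.Unit using (tt)
open import Data.Empty using (⊥; ⊥-elim)
open import Data.List using (List; []; _∷_; _++_; map; foldr; length)
open import Data.List.Properties
  using ( ∷-injective; ++-assoc; ++-identityʳ; length-++; length-map
        ; map-++; map-id; map-∘; map-cong; map-cong-local; map-injective)
open import Data.List.Membership.Propositional using (_∈_; _∉_)
open import Data.List.Membership.Propositional.Properties using (∈-map⁺; ∈-map⁻; ∈-++⁺ˡ; ∈-++⁺ʳ; ∈-++⁻)
open import Data.List.Relation.Unary.Any using (here; there)
open import Data.List.Relation.Unary.All as All using (All; []; _∷_)
import Data.List.Relation.Unary.All.Properties as All
open import Data.List.Relation.Unary.Unique.Propositional using (Unique)
import Data.List.Relation.Unary.Unique.Propositional.Properties as Unique
open import Data.List.Relation.Unary.AllPairs using ([]; _∷_)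
open import Data.Product using (_×_; _,_; proj₁; proj₂; ∃-syntax)
open import Data.Sum using (_⊎_; inj₁; inj₂)
open import Relation.Binary.PropositionalEquality
  using (_≡_; _≢_; refl; sym; trans; cong; cong₂; subst; module ≡-Reasoning)
open import Relation.Binary.Definitions using (tri<; tri≈; tri>)
open import Relation.Nullary using (¬_; yes; no)
open import Function.Bundles using (_⇔_; mk⇔; Equivalence)

module _ {A B : Set} {R : A → A → Set} {S : B → B → Set} (f : A → B)
         (f-injective : ∀ {x y} → f x ≡ f y → x ≡ y)
         (f-preserves : ∀ {x y} → R x y → S (f x) (f y))
         (f-lifts : ∀ {x b} → S (f x) b → ∃[ y ] R x y × f y ≡ b)
         where

  Steps-map : ∀ {n x y} → Steps R n x y → Steps S n (f x) (f y)
  Steps-map done        = done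
  Steps-map (step r rs) = step (f-preserves r) (Steps-map rs)

  Steps-lift : ∀ {n x b} → Steps S n (f x) b → ∃[ y ] Steps R n x y × f y ≡ b
  Steps-lift done = _ , done , refl
  Steps-lift (step s ss) with f-lifts s
  ... | _ , r , refl with Steps-lift ss
  ...   | y , rs , fy≡b = y , step r rs , fy≡b

  Steps-reflect : ∀ {n x y} → Steps S n (f x) (f y) → Steps R n x y
  Steps-reflect ss with Steps-lift ss
  ... | _ , rs , fz≡fy = subst (Steps R _ _) (f-injective fz≡fy) rs

  IsDist-transport : ∀ {x y n} → IsDist R x y n ⇔ IsDist S (f x) (f y) n
  IsDist-transport = mk⇔
    (λ (rs , minimal) → Steps-map rs , λ m ss → minimal m (Steps-reflect ss))
    (λ (ss , minimal) → Steps-reflect ss , λ m rs → minimal m (Steps-map rs))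

module _ {A : Set} where

  ++-split : (a b c d : List A) → a ++ b ≡ c ++ d →
    (∃[ z ] ∃[ r ] c ≡ a ++ z ∷ r × b ≡ z ∷ r ++ d) ⊎ (∃[ r ] a ≡ c ++ r × d ≡ r ++ b)
  ++-split []      b []      d eq = inj₂ ([] , refl , sym eq)
  ++-split []      b (z ∷ r) d eq = inj₁ (z , r , refl , eq)
  ++-split (x ∷ a) b []      d eq = inj₂ (x ∷ a , refl , sym eq)
  ++-split (x ∷ a) b (y ∷ c) d eq with ∷-injective eq
  ... | refl , eq′ with ++-split a b c d eq′
  ...   | inj₁ (z , r , c≡ , b≡) = inj₁ (z , r , cong (x ∷_) c≡ , b≡)
  ...   | inj₂ (r , a≡ , d≡)     = inj₂ (r , cong (x ∷_) a≡ , d≡)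

  ++-cancel-length : (a b c d : List A) → a ++ b ≡ c ++ d → length a ≡ length c → a ≡ c × b ≡ d
  ++-cancel-length []      b []      d eq _  = refl , eq
  ++-cancel-length (x ∷ a) b (y ∷ c) d eq eqₗ with ∷-injective eq
  ... | refl , eq′ with ++-cancel-length a b c d eq′ (cong pred eqₗ)
  ...   | refl , b≡d = refl , b≡d

  ∉-before-unique : ∀ {z : A} p r → Unique (p ++ z ∷ r) → z ∉ p
  ∉-before-unique (_ ∷ p) r (z∉ ∷ _) (here refl) = All.lookup z∉ (∈-++⁺ʳ p (here refl)) refl
  ∉-before-unique (_ ∷ p) r (_ ∷ u)  (there z∈) = ∉-before-unique p r u z∈

  ∈-middle : ∀ {w u v} {x : A} → w ≡ u ++ x ∷ v → x ∈ w
  ∈-middle {u = u} refl = ∈-++⁺ʳ u (here refl)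

map-split : ∀ {A B : Set} (h : A → B) xs p q → map h xs ≡ p ++ q →
  ∃[ p₀ ] ∃[ q₀ ] xs ≡ p₀ ++ q₀ × p ≡ map h p₀ × q ≡ map h q₀
map-split h xs       []      q eq = [] , xs , refl , refl , sym eq
map-split h (y ∷ xs) (x ∷ p) q eq with ∷-injective eq
... | refl , eq′ with map-split h xs p q eq′
...   | p₀ , q₀ , refl , refl , refl = y ∷ p₀ , q₀ , refl , refl , refl

shift : ℕ → List ℕ → List ℕ
shift a = map (a +_)

shift-shift : ∀ a b w → shift a (shift b w) ≡ shift (a + b) w
shift-shift a b w = trans (sym (map-∘ w)) (map-cong (λ x → sym (+-assoc a b x)) w)

shift-zero : ∀ w → shift 0 w ≡ w
shift-zero = map-id

All-shift : ∀ {P Q : ℕ → Set} a {w} → (∀ {x} → P x → Q (a + x)) → All P w → All Q (shift a w)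
All-shift a P⇒Q ps = All.map⁺ (All.map P⇒Q ps)

≤-maxL : ∀ {x} w → x ∈ w → x ≤ maxL w
≤-maxL (y ∷ w) (here refl) = m≤m⊔n y (maxL w)
≤-maxL (y ∷ w) (there x∈w) = ≤-trans (≤-maxL w x∈w) (m≤n⊔m y (maxL w))

maxL-≤ : ∀ {m} w → All (_≤ m) w → maxL w ≤ m
maxL-≤ []      []         = z≤n
maxL-≤ (y ∷ w) (y≤ ∷ w≤) = ⊔-lub y≤ (maxL-≤ w w≤)

minL-≤ : ∀ {x} w → x ∈ w → minL w ≤ x
minL-≤ (y ∷ ys) (here refl) = foldr-⊓-≤-seed y ys
  where
  foldr-⊓-≤-seed : ∀ y ys → foldr _⊓_ y ys ≤ y
  foldr-⊓-≤-seed y []       = ≤-refl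
  foldr-⊓-≤-seed y (z ∷ zs) = ≤-trans (m⊓n≤n z _) (foldr-⊓-≤-seed y zs)
minL-≤ (y ∷ ys) (there x∈) = foldr-⊓-≤ ys x∈
  where
  foldr-⊓-≤ : ∀ {x} ys → x ∈ ys → foldr _⊓_ y ys ≤ x
  foldr-⊓-≤ (z ∷ zs) (here refl) = m⊓n≤m z _
  foldr-⊓-≤ (z ∷ zs) (there x∈)  = ≤-trans (m⊓n≤n z _) (foldr-⊓-≤ zs x∈)

≤-minL : ∀ {m} y ys → All (m ≤_) (y ∷ ys) → m ≤ minL (y ∷ ys)
≤-minL {m} y ys (m≤y ∷ m≤ys) = go ys m≤ys
  where
  go : ∀ ys → All (m ≤_) ys → m ≤ foldr _⊓_ y ys
  go []       []           = m≤y
  go (z ∷ zs) (m≤z ∷ m≤zs) = ⊓-glb m≤z (go zs m≤zs)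

maxL-∷-≥ : ∀ {a} w → All (_≤ a) w → maxL (a ∷ w) ≡ a
maxL-∷-≥ w w≤a = m≥n⇒m⊔n≡m (maxL-≤ w w≤a)

maxL-shift : ∀ a y ys → maxL (shift a (y ∷ ys)) ≡ a + maxL (y ∷ ys)
maxL-shift a y []       = trans (⊔-identityʳ _) (cong (a +_) (sym (⊔-identityʳ y)))
maxL-shift a y (z ∷ zs) = trans (cong ((a + y) ⊔_) (maxL-shift a z zs)) (sym (+-distribˡ-⊔ a y _))

minL-shift : ∀ a y ys → minL (shift a (y ∷ ys)) ≡ a + minL (y ∷ ys)
minL-shift a y []       = refl
minL-shift a y (z ∷ zs) = trans (cong ((a + z) ⊓_) (minL-shift a y zs)) (sym (+-distribˡ-⊓ a z _))

∈-shift⁻ : ∀ a {x} w → a + x ∈ shift a w → x ∈ w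
∈-shift⁻ a w a+x∈ with ∈-map⁻ (a +_) a+x∈
... | z , z∈w , a+x≡a+z = subst (_∈ w) (sym (+-cancelˡ-≡ a _ _ a+x≡a+z)) z∈w

compact-shift⁺ : ∀ a f → Compact f → Compact (shift a f)
compact-shift⁺ a []       (f≢[] , _)     = ⊥-elim (f≢[] refl)
compact-shift⁺ a (y ∷ ys) (_ , interval) = (λ ()) , λ x → mk⇔ (to x) (from x)
  where
  f = y ∷ ys
  to : ∀ x → x ∈ shift a f → minL (shift a f) ≤ x × x ≤ maxL (shift a f)
  to x x∈ with ∈-map⁻ (a +_) x∈
  ... | z , z∈f , refl rewrite minL-shift a y ys | maxL-shift a y ys =
    let lo≤z , z≤hi = Equivalence.to (interval z) z∈f in +-monoʳ-≤ a lo≤z , +-monoʳ-≤ a z≤hi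
  from : ∀ x → minL (shift a f) ≤ x × x ≤ maxL (shift a f) → x ∈ shift a f
  from x (lo≤x , x≤hi) rewrite minL-shift a y ys | maxL-shift a y ys with m≤n⇒∃[o]m+o≡n lo≤x
  ... | k , refl = subst (_∈ shift a f) (sym (+-assoc a _ k))
    (∈-map⁺ (a +_) (Equivalence.from (interval (minL f + k))
      (m≤m+n _ k , +-cancelˡ-≤ a _ _ (subst (_≤ a + maxL f) (+-assoc a _ k) x≤hi))))

compact-shift⁻ : ∀ a f → Compact (shift a f) → Compact f
compact-shift⁻ a []       (f≢[] , _)     = ⊥-elim (f≢[] refl)
compact-shift⁻ a (y ∷ ys) (_ , interval) = (λ ()) , λ x → mk⇔ (to x) (from x)
  where
  f = y ∷ ys
  to : ∀ x → x ∈ f → minL f ≤ x × x ≤ maxL f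
  to x x∈f with Equivalence.to (interval (a + x)) (∈-map⁺ (a +_) x∈f)
  ... | lo≤ , ≤hi rewrite minL-shift a y ys | maxL-shift a y ys =
    +-cancelˡ-≤ a _ _ lo≤ , +-cancelˡ-≤ a _ _ ≤hi
  from : ∀ x → minL f ≤ x × x ≤ maxL f → x ∈ f
  from x (lo≤x , x≤hi) = ∈-shift⁻ a f (Equivalence.from (interval (a + x)) bounds)
    where
    bounds : minL (shift a f) ≤ a + x × a + x ≤ maxL (shift a f)
    bounds rewrite minL-shift a y ys | maxL-shift a y ys = +-monoʳ-≤ a lo≤x , +-monoʳ-≤ a x≤hi

compact-no-gap : ∀ {b z y} p q → All (_< b) (z ∷ p) → All (b <_) (y ∷ q) → ¬ Compact ((z ∷ p) ++ y ∷ q)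
compact-no-gap {b} {z} {y} p q p<b b<q (_ , interval) = b∉ (Equivalence.from (interval b) (minL≤b , b≤maxL))
  where
  w = (z ∷ p) ++ y ∷ q
  minL≤b : minL w ≤ b
  minL≤b = ≤-trans (minL-≤ w (here refl)) (<⇒≤ (All.head p<b))
  b≤maxL : b ≤ maxL w
  b≤maxL = ≤-trans (<⇒≤ (All.head b<q)) (≤-maxL w (∈-++⁺ʳ (z ∷ p) (here refl)))
  b∉ : b ∉ w
  b∉ b∈ with ∈-++⁻ (z ∷ p) b∈
  ... | inj₁ b∈p = <-irrefl refl (All.lookup p<b b∈p)
  ... | inj₂ b∈q = <-irrefl refl (All.lookup b<q b∈q)

complete-[] : ∀ f → Compact f → Complete f []
complete-[] f compact = compact , λ { [] _ _ g≢[] → ⊥-elim (g≢[] refl) ; (_ ∷ _) _ () }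

complete-++⁻ : ∀ f v X → Complete f (v ++ X) → Complete f v
complete-++⁻ f v X (compact , maximal) =
  compact , λ g w v≡ → maximal g (w ++ X) (trans (cong (_++ X) v≡) (++-assoc g w X))

complete-++⁺ : ∀ f v X → Complete f v → All (maxL f <_) X → Complete f (v ++ X)
complete-++⁺ f v X (compact , maximal) X-above =
  compact , λ g w v++X≡ g≢[] → extension g w g≢[] (++-split g w v X (sym v++X≡))
  where
  extension : ∀ g w → g ≢ [] →
    (∃[ z ] ∃[ r ] v ≡ g ++ z ∷ r × w ≡ z ∷ r ++ X) ⊎ (∃[ r ] g ≡ v ++ r × X ≡ r ++ w) →
    Compact (f ++ g) → maxL (f ++ g) ≢ maxL f
  extension g w g≢[] (inj₁ (z , r , v≡ , _))  = maximal g (z ∷ r) v≡ g≢[]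
  extension g w g≢[] (inj₂ ([] , g≡ , _))     =
    maximal g [] (trans (sym (++-identityʳ v)) (trans (sym g≡) (sym (++-identityʳ g)))) g≢[]
  extension g w g≢[] (inj₂ (y ∷ r , g≡ , X≡)) _ max≡ = <⇒≱ maxf<y y≤max
    where
    maxf<y : maxL f < y
    maxf<y = All.lookup X-above (subst (y ∈_) (sym X≡) (here refl))
    y≤max : y ≤ maxL f
    y≤max = subst (y ≤_) max≡ (≤-maxL (f ++ g) (∈-++⁺ʳ f (subst (y ∈_) (sym g≡) (∈-++⁺ʳ v (here refl)))))

complete-shift⁺ : ∀ a f v → Complete f v → Complete (shift a f) (shift a v)
complete-shift⁺ a []       v ((f≢[] , _) , _)      = ⊥-elim (f≢[] refl)
complete-shift⁺ a (y ∷ ys) v (compact , maximal) = compact-shift⁺ a (y ∷ ys) compact , extension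
  where
  f = y ∷ ys
  extension : ∀ g w → shift a v ≡ g ++ w → g ≢ [] →
              Compact (shift a f ++ g) → maxL (shift a f ++ g) ≢ maxL (shift a f)
  extension g w shift≡ g≢[] compact-fg max≡ with map-split (a +_) v g w shift≡
  ... | [] , _ , _ , refl , _ = g≢[] refl
  ... | g₀@(_ ∷ _) , w₀ , v≡ , refl , _ =
    maximal g₀ w₀ v≡ (λ ()) (compact-shift⁻ a (f ++ g₀) (subst Compact shift-++ compact-fg))
      (+-cancelˡ-≡ a _ _ (begin
        a + maxL (f ++ g₀)          ≡⟨ maxL-shift a y (ys ++ g₀) ⟨
        maxL (shift a (f ++ g₀))    ≡⟨ cong maxL shift-++ ⟨
        maxL (shift a f ++ shift a g₀) ≡⟨ max≡ ⟩
        maxL (shift a f)            ≡⟨ maxL-shift a y ys ⟩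
        a + maxL f ∎))
    where
    open ≡-Reasoning
    shift-++ : shift a f ++ shift a g₀ ≡ shift a (f ++ g₀)
    shift-++ = sym (map-++ (a +_) f g₀)

complete-shift⁻ : ∀ a f v → Complete (shift a f) (shift a v) → Complete f v
complete-shift⁻ a []       v ((f≢[] , _) , _)      = ⊥-elim (f≢[] refl)
complete-shift⁻ a (y ∷ ys) v (compact , maximal) = compact-shift⁻ a (y ∷ ys) compact , extension
  where
  f = y ∷ ys
  extension : ∀ g w → v ≡ g ++ w → g ≢ [] → Compact (f ++ g) → maxL (f ++ g) ≢ maxL f
  extension [] _ _ g≢[] _ = ⊥-elim (g≢[] refl)
  extension g@(_ ∷ _) w v≡ _ compact-fg max≡ =
    maximal (shift a g) (shift a w) (trans (cong (shift a) v≡) (map-++ _ g w)) (λ ())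
      (subst Compact shift-++ (compact-shift⁺ a (f ++ g) compact-fg))
      (begin
        maxL (shift a f ++ shift a g) ≡⟨ cong maxL shift-++ ⟨
        maxL (shift a (f ++ g))       ≡⟨ maxL-shift a y (ys ++ g) ⟩
        a + maxL (f ++ g)             ≡⟨ cong (a +_) max≡ ⟩
        a + maxL f                    ≡⟨ maxL-shift a y ys ⟨
        maxL (shift a f) ∎)
    where
    open ≡-Reasoning
    shift-++ : shift a (f ++ g) ≡ shift a f ++ shift a g
    shift-++ = map-++ (a +_) f g

bump₁ : ℕ → ℕ → ℕ
bump₁ a x = if a ≤ᵇ x then suc x else x

unbump₁ : ℕ → ℕ → ℕ
unbump₁ b x = if b <ᵇ x then pred x else x

bump₁-≥ : ∀ {a x} → a ≤ x → bump₁ a x ≡ suc x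
bump₁-≥ {a} {x} a≤x with a ≤ᵇ x | ≤⇒≤ᵇ a≤x
... | true | _ = refl

bump₁-< : ∀ {a x} → x < a → bump₁ a x ≡ x
bump₁-< {a} {x} x<a with a ≤ᵇ x | ≤ᵇ⇒≤ a x
... | false | _   = refl
... | true  | a≤x = ⊥-elim (<⇒≱ x<a (a≤x tt))

unbump₁-> : ∀ {b x} → b < x → unbump₁ b x ≡ pred x
unbump₁-> {b} {x} b<x with b <ᵇ x | <⇒<ᵇ b<x
... | true | _ = refl

unbump₁-≤ : ∀ {b x} → x ≤ b → unbump₁ b x ≡ x
unbump₁-≤ {b} {x} x≤b with b <ᵇ x | <ᵇ⇒< b x
... | false | _   = refl
... | true  | b<x = ⊥-elim (<⇒≱ (b<x tt) x≤b)

bump₁-+ : ∀ a b x → bump₁ (a + b) (a + x) ≡ a + bump₁ b x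
bump₁-+ a b x with b ≤? x
... | yes b≤x = trans (bump₁-≥ (+-monoʳ-≤ a b≤x)) (trans (sym (+-suc a x)) (cong (a +_) (sym (bump₁-≥ b≤x))))
... | no  b≰x = trans (bump₁-< (+-monoʳ-< a (≰⇒> b≰x))) (cong (a +_) (sym (bump₁-< (≰⇒> b≰x))))

unbump₁-+ : ∀ a b x → unbump₁ (a + b) (a + x) ≡ a + unbump₁ b x
unbump₁-+ a b x with b <? x
unbump₁-+ a b (suc x) | yes b<x =
  trans (unbump₁-> (+-monoʳ-< a b<x)) (trans (cong pred (+-suc a x)) (cong (a +_) (sym (unbump₁-> b<x))))
... | no b≮x = trans (unbump₁-≤ (+-monoʳ-≤ a (≮⇒≥ b≮x))) (cong (a +_) (sym (unbump₁-≤ (≮⇒≥ b≮x))))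

bump-< : ∀ {a w} → All (_< a) w → bump a w ≡ w
bump-< {w = w} w<a = trans (map-cong-local (All.map bump₁-< w<a)) (map-id w)

unbump-≤ : ∀ {b w} → All (_≤ b) w → unbump b w ≡ w
unbump-≤ {w = w} w≤b = trans (map-cong-local (All.map unbump₁-≤ w≤b)) (map-id w)

bump-≥ : ∀ {a w} → All (a ≤_) w → bump a w ≡ map suc w
bump-≥ a≤w = map-cong-local (All.map bump₁-≥ a≤w)

unbump-> : ∀ {b w} → All (b <_) w → unbump b w ≡ map pred w
unbump-> b<w = map-cong-local (All.map unbump₁-> b<w)

bump-shift : ∀ a b w → bump (a + b) (shift a w) ≡ shift a (bump b w)
bump-shift a b w = trans (sym (map-∘ w)) (trans (map-cong (bump₁-+ a b) w) (map-∘ w))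

unbump-shift : ∀ a b w → unbump (a + b) (shift a w) ≡ shift a (unbump b w)
unbump-shift a b w = trans (sym (map-∘ w)) (trans (map-cong (unbump₁-+ a b) w) (map-∘ w))

suc-shift : ∀ c w → map suc (shift c w) ≡ shift (suc c) w
suc-shift c w = sym (map-∘ w)

pred-shift : ∀ c w → map pred (shift (suc c) w) ≡ shift c w
pred-shift c w = sym (map-∘ w)

bump-shift-≥ : ∀ {b} c {w} → All (λ x → b ≤ c + x) w → bump b (shift c w) ≡ shift (suc c) w
bump-shift-≥ c {w} b≤ = trans (bump-≥ (All.map⁺ b≤)) (suc-shift c w)

unbump-shift-> : ∀ {b} c {w} → All (λ x → b < suc c + x) w → unbump b (shift (suc c) w) ≡ shift c w
unbump-shift-> c {w} b< = trans (unbump-> (All.map⁺ b<)) (pred-shift c w)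

size : List Tree → ℕ
size []             = 0
size (node cs ∷ ts) = suc (size cs + size ts)

Θs : List Tree → List ℕ
Θs []             = []
Θs (node cs ∷ ts) = suc (size cs) ∷ Θs cs ++ shift (suc (size cs)) (Θs ts)

thetaF≡ : ∀ s ts → thetaF s ts ≡ (shift s (Θs ts) , s + size ts)
thetaF≡ s []             = cong ([] ,_) (sym (+-identityʳ s))
thetaF≡ s (node cs ∷ ts) rewrite thetaF≡ s cs | thetaF≡ (suc (s + size cs)) ts =
  cong₂ _,_ (cong₂ _∷_ (sym (+-suc s (size cs))) word) (trans (cong suc (+-assoc s _ _)) (sym (+-suc s _)))
  where
  open ≡-Reasoning
  word : shift s (Θs cs) ++ shift (suc (s + size cs)) (Θs ts) ≡
         shift s (Θs cs ++ shift (suc (size cs)) (Θs ts))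
  word = begin
    shift s (Θs cs) ++ shift (suc (s + size cs)) (Θs ts)
        ≡⟨ cong (λ k → shift s (Θs cs) ++ shift k (Θs ts)) (+-suc s (size cs)) ⟨
    shift s (Θs cs) ++ shift (s + suc (size cs)) (Θs ts)
        ≡⟨ cong (_ ++_) (shift-shift s _ (Θs ts)) ⟨
    shift s (Θs cs) ++ shift s (shift (suc (size cs)) (Θs ts))
        ≡⟨ map-++ (s +_) (Θs cs) _ ⟨
    shift s (Θs cs ++ shift (suc (size cs)) (Θs ts)) ∎

Θ≡Θs : ∀ cs → Θ (node cs) ≡ Θs cs
Θ≡Θs cs = trans (cong proj₁ (thetaF≡ 0 cs)) (shift-zero (Θs cs))

size-++ : ∀ ts ts′ → size (ts ++ ts′) ≡ size ts + size ts′
size-++ []             ts′ = refl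
size-++ (node cs ∷ ts) ts′ =
  cong suc (trans (cong (size cs +_) (size-++ ts ts′)) (sym (+-assoc (size cs) _ _)))

Θs-++ : ∀ ts ts′ → Θs (ts ++ ts′) ≡ Θs ts ++ shift (size ts) (Θs ts′)
Θs-++ []             ts′ = sym (shift-zero _)
Θs-++ (node cs ∷ ts) ts′ = cong (a ∷_) (begin
  Θs cs ++ shift a (Θs (ts ++ ts′))
      ≡⟨ cong (λ w → Θs cs ++ shift a w) (Θs-++ ts ts′) ⟩
  Θs cs ++ shift a (Θs ts ++ shift (size ts) (Θs ts′))
      ≡⟨ cong (Θs cs ++_) (map-++ (a +_) (Θs ts) _) ⟩
  Θs cs ++ shift a (Θs ts) ++ shift a (shift (size ts) (Θs ts′))
      ≡⟨ cong (λ w → Θs cs ++ shift a (Θs ts) ++ w) (shift-shift a (size ts) _) ⟩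
  Θs cs ++ shift a (Θs ts) ++ shift (a + size ts) (Θs ts′)
      ≡⟨ ++-assoc (Θs cs) _ _ ⟨
  (Θs cs ++ shift a (Θs ts)) ++ shift (a + size ts) (Θs ts′) ∎)
  where
  open ≡-Reasoning
  a = suc (size cs)

size-del : ∀ {ts ts′} → DelF ts ts′ → size ts ≡ suc (size ts′)
size-del (here cs ts)            = cong suc (sym (size-++ cs ts))
size-del (deep ts (inside d))    = cong (λ k → suc (k + size ts)) (size-del d)
size-del (later (node cs) d)     = cong suc (trans (cong (size cs +_) (size-del d)) (+-suc (size cs) _))

DelF-++ˡ : ∀ ts {ts₁ ts₂} → DelF ts₁ ts₂ → DelF (ts ++ ts₁) (ts ++ ts₂)
DelF-++ˡ []       d = d
DelF-++ˡ (t ∷ ts) d = later t (DelF-++ˡ ts d)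

Θs-bounded : ∀ ts → All (λ x → 1 ≤ x × x ≤ size ts) (Θs ts)
Θs-bounded []             = []
Θs-bounded (node cs ∷ ts) =
  (s≤s z≤n , s≤s (m≤m+n (size cs) (size ts))) ∷
  All.++⁺ (All.map (λ (1≤x , x≤) → 1≤x , m≤n⇒m≤1+n (≤-trans x≤ (m≤m+n (size cs) (size ts)))) (Θs-bounded cs))
          (All-shift (suc (size cs)) (λ (1≤x , x≤) → s≤s z≤n , s≤s (+-monoʳ-≤ (size cs) x≤)) (Θs-bounded ts))

Θs-positive : ∀ ts → All (1 ≤_) (Θs ts)
Θs-positive ts = All.map proj₁ (Θs-bounded ts)

Θs-≤-size : ∀ ts → All (_≤ size ts) (Θs ts)
Θs-≤-size ts = All.map proj₂ (Θs-bounded ts)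

Θs-shift-> : ∀ a ts → All (a <_) (shift a (Θs ts))
Θs-shift-> a ts = All-shift a (m<m+n a) (Θs-positive ts)

∈-Θs : ∀ ts {x} → 1 ≤ x → x ≤ size ts → x ∈ Θs ts
∈-Θs []             (s≤s z≤n) ()
∈-Θs (node cs ∷ ts) {x} 1≤x x≤size with <-cmp x (suc (size cs))
... | tri≈ _ x≡a _ = here x≡a
... | tri< x<a _ _ = there (∈-++⁺ˡ (∈-Θs cs 1≤x (≤-pred x<a)))
... | tri> _ _ a<x with m≤n⇒∃[o]m+o≡n a<x
...   | k , refl =
  there (∈-++⁺ʳ (Θs cs) (subst (_∈ shift a (Θs ts)) (+-suc a k) (∈-map⁺ (a +_) (∈-Θs ts (s≤s z≤n) 1+k≤size))))
  where
  a = suc (size cs)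
  1+k≤size : suc k ≤ size ts
  1+k≤size = +-cancelˡ-≤ a _ _ (subst (_≤ a + size ts) (sym (+-suc a k)) x≤size)

length-Θs : ∀ ts → length (Θs ts) ≡ size ts
length-Θs []             = refl
length-Θs (node cs ∷ ts) = cong suc (trans (length-++ (Θs cs))
  (cong₂ _+_ (length-Θs cs) (trans (length-map _ (Θs ts)) (length-Θs ts))))

maxL-Θs : ∀ ts → maxL (Θs ts) ≡ size ts
maxL-Θs []             = refl
maxL-Θs (node cs ∷ ts) = ≤-antisym (maxL-≤ _ (Θs-≤-size (node cs ∷ ts)))
                                   (≤-maxL _ (∈-Θs (node cs ∷ ts) (s≤s z≤n) ≤-refl))

minL-Θs : ∀ cs ts → minL (Θs (node cs ∷ ts)) ≡ 1
minL-Θs cs ts = ≤-antisym (minL-≤ _ (∈-Θs (node cs ∷ ts) ≤-refl (s≤s z≤n)))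
                          (≤-minL _ _ (Θs-positive (node cs ∷ ts)))

Θs-compact : ∀ cs ts → Compact (Θs (node cs ∷ ts))
Θs-compact cs ts rewrite minL-Θs cs ts | maxL-Θs (node cs ∷ ts) =
  (λ ()) , λ x → mk⇔ (All.lookup (Θs-bounded (node cs ∷ ts)))
                     (λ (1≤x , x≤size) → ∈-Θs (node cs ∷ ts) 1≤x x≤size)

Θs-unique : ∀ ts → Unique (Θs ts)
Θs-unique []             = []
Θs-unique (node cs ∷ ts) =
  All.++⁺ (All.map (λ (_ , x≤) a≡x → <⇒≢ (s≤s x≤) (sym a≡x)) (Θs-bounded cs))
          (All.map (λ a<x a≡x → <⇒≢ a<x a≡x) (Θs-shift-> a ts))
  ∷ Unique.++⁺ (Θs-unique cs) (Unique.map⁺ (+-cancelˡ-≡ a _ _) (Θs-unique ts)) disjoint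
  where
  a = suc (size cs)
  disjoint : ∀ {x} → x ∈ Θs cs × x ∈ shift a (Θs ts) → ⊥
  disjoint (x∈cs , x∈ts) =
    <⇒≱ (All.lookup (Θs-shift-> a ts) x∈ts) (m≤n⇒m≤1+n (All.lookup (Θs-≤-size cs) x∈cs))

Θs-injective : ∀ ts ts′ → Θs ts ≡ Θs ts′ → ts ≡ ts′
Θs-injective []             []               _  = refl
Θs-injective []             (node _ ∷ _)     ()
Θs-injective (node _ ∷ _)   []               ()
Θs-injective (node cs ∷ ts) (node cs′ ∷ ts′) eq with ∷-injective eq
... | a≡a′ , eq′ with ++-cancel-length (Θs cs) _ (Θs cs′) _ eq′
                        (trans (length-Θs cs) (trans (cong pred a≡a′) (sym (length-Θs cs′))))
...   | cs≡ , ts≡ with Θs-injective cs cs′ cs≡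
...     | refl = cong (node cs ∷_) (Θs-injective ts ts′ (map-injective (+-cancelˡ-≡ (suc (size cs)) _ _) ts≡))

Θs≡[] : ∀ {ts} → Θs ts ≡ [] → ts ≡ []
Θs≡[] {[]}         _  = refl
Θs≡[] {node _ ∷ _} ()

Θs-shift-above : ∀ ts ts′ → All (maxL (Θs ts) <_) (shift (size ts) (Θs ts′))
Θs-shift-above ts ts′ rewrite maxL-Θs ts = Θs-shift-> (size ts) ts′

Θs-complete : ∀ cs ts ts′ → Complete (Θs (node cs ∷ ts)) (shift (size (node cs ∷ ts)) (Θs ts′))
Θs-complete cs ts ts′ =
  complete-++⁺ _ [] _ (complete-[] _ (Θs-compact cs ts)) (Θs-shift-above (node cs ∷ ts) ts′)

-- Edge contractions are letter deletions

-- PermDel and PermIns with their index equations made explicit, so that they can be matched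
-- against words such as Θs ts that are not constructor patterns.
data Deletion (w w′ : List ℕ) : Set where
  deletion : ∀ u x v → w ≡ u ++ x ∷ v → w′ ≡ unbump x u ++ unbump x v → Deletion w w′

Deletion⇔PermDel : ∀ {w w′} → Deletion w w′ ⇔ PermDel w w′
Deletion⇔PermDel = mk⇔ (λ { (deletion u x v refl refl) → del u x v })
                       (λ { (del u x v) → deletion u x v refl refl })

Θs-del-here : ∀ cs ts → Θs (cs ++ ts) ≡ unbump (suc (size cs)) (Θs cs ++ shift (suc (size cs)) (Θs ts))
Θs-del-here cs ts = begin
  Θs (cs ++ ts)
      ≡⟨ Θs-++ cs ts ⟩
  Θs cs ++ shift (size cs) (Θs ts)
      ≡⟨ cong₂ _++_ (unbump-≤ cs≤a) (unbump-shift-> (size cs) ts>a) ⟨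
  unbump a (Θs cs) ++ unbump a (shift a (Θs ts))
      ≡⟨ map-++ _ (Θs cs) _ ⟨
  unbump a (Θs cs ++ shift a (Θs ts)) ∎
  where
  open ≡-Reasoning
  a = suc (size cs)
  cs≤a : All (_≤ a) (Θs cs)
  cs≤a = All.map m≤n⇒m≤1+n (Θs-≤-size cs)
  ts>a : All (λ x → a < a + x) (Θs ts)
  ts>a = All.map (m<m+n a) (Θs-positive ts)

Θs-del-deep : ∀ {cs cs′} ts u x v → size cs ≡ suc (size cs′) → x ≤ size cs →
  Θs cs′ ≡ unbump x u ++ unbump x v →
  Θs (node cs′ ∷ ts) ≡ unbump x (suc (size cs) ∷ u) ++ unbump x (v ++ shift (suc (size cs)) (Θs ts))
Θs-del-deep {cs′ = cs′} ts u x v size≡ x≤ eq rewrite size≡ = begin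
  a ∷ Θs cs′ ++ shift a W
      ≡⟨ cong (λ w → a ∷ w ++ shift a W) eq ⟩
  a ∷ (unbump x u ++ unbump x v) ++ shift a W
      ≡⟨ cong (a ∷_) (++-assoc (unbump x u) _ _) ⟩
  a ∷ unbump x u ++ unbump x v ++ shift a W
      ≡⟨ cong₂ (λ y w → y ∷ unbump x u ++ unbump x v ++ w) (unbump₁-> (s≤s x≤)) (unbump-shift-> a x<W) ⟨
  unbump₁ x (suc a) ∷ unbump x u ++ unbump x v ++ unbump x (shift (suc a) W)
      ≡⟨ cong (λ w → _ ∷ unbump x u ++ w) (map-++ _ v _) ⟨
  unbump x (suc a ∷ u) ++ unbump x (v ++ shift (suc a) W) ∎
  where
  open ≡-Reasoning
  a = suc (size cs′)
  W = Θs ts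
  x<W : All (λ y → x < suc a + y) W
  x<W = All.universal (λ y → s≤s (≤-trans x≤ (m≤m+n a y))) W

Θs-del-later : ∀ cs {ts′} u x v → Θs ts′ ≡ unbump x u ++ unbump x v →
  Θs (node cs ∷ ts′) ≡ unbump (suc (size cs) + x) (suc (size cs) ∷ Θs cs ++ shift (suc (size cs)) u)
                       ++ unbump (suc (size cs) + x) (shift (suc (size cs)) v)
Θs-del-later cs u x v eq = begin
  (a ∷ Θs cs) ++ shift a (Θs _)
      ≡⟨ cong (λ w → (a ∷ Θs cs) ++ shift a w) eq ⟩
  (a ∷ Θs cs) ++ shift a (unbump x u ++ unbump x v)
      ≡⟨ cong ((a ∷ Θs cs) ++_) (map-++ _ (unbump x u) _) ⟩
  (a ∷ Θs cs) ++ shift a (unbump x u) ++ shift a (unbump x v)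
      ≡⟨ cong₂ (λ p q → p ++ q ++ shift a (unbump x v)) (unbump-≤ prefix≤) (unbump-shift a x u) ⟨
  unbump b (a ∷ Θs cs) ++ unbump b (shift a u) ++ shift a (unbump x v)
      ≡⟨ cong (λ w → unbump b (a ∷ Θs cs) ++ unbump b (shift a u) ++ w) (unbump-shift a x v) ⟨
  unbump b (a ∷ Θs cs) ++ unbump b (shift a u) ++ unbump b (shift a v)
      ≡⟨ ++-assoc (unbump b (a ∷ Θs cs)) _ _ ⟨
  (unbump b (a ∷ Θs cs) ++ unbump b (shift a u)) ++ unbump b (shift a v)
      ≡⟨ cong (_++ unbump b (shift a v)) (map-++ _ (a ∷ Θs cs) _) ⟨
  unbump b (a ∷ Θs cs ++ shift a u) ++ unbump b (shift a v) ∎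
  where
  open ≡-Reasoning
  a = suc (size cs)
  b = a + x
  prefix≤ : All (_≤ b) (a ∷ Θs cs)
  prefix≤ = All.map (λ y≤a → ≤-trans y≤a (m≤m+n a x)) (≤-refl ∷ All.map m≤n⇒m≤1+n (Θs-≤-size cs))

Θs-del : ∀ {ts ts′} → DelF ts ts′ → Deletion (Θs ts) (Θs ts′)
Θs-del (here cs ts) = deletion [] (suc (size cs)) _ refl (Θs-del-here cs ts)
Θs-del (deep ts (inside {cs} d)) with Θs-del d
... | deletion u x v cs≡ cs′≡ =
  deletion (a ∷ u) x (v ++ shift a (Θs ts))
    (cong (a ∷_) (trans (cong (_++ shift a (Θs ts)) cs≡) (++-assoc u (x ∷ v) _)))
    (Θs-del-deep ts u x v (size-del d) (All.lookup (Θs-≤-size cs) (∈-middle cs≡)) cs′≡)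
  where a = suc (size cs)
Θs-del (later (node cs) {ts} d) with Θs-del d
... | deletion u x v ts≡ ts′≡ =
  deletion (a ∷ Θs cs ++ shift a u) (a + x) (shift a v) (cong (a ∷_) word) (Θs-del-later cs u x v ts′≡)
  where
  a = suc (size cs)
  word : Θs cs ++ shift a (Θs ts) ≡ (Θs cs ++ shift a u) ++ (a + x) ∷ shift a v
  word = trans (cong (λ w → Θs cs ++ shift a w) ts≡)
               (trans (cong (Θs cs ++_) (map-++ (a +_) u (x ∷ v))) (sym (++-assoc (Θs cs) _ _)))

Θs-del⁻¹ : ∀ ts u x v → Θs ts ≡ u ++ x ∷ v → ∃[ ts′ ] DelF ts ts′ × Θs ts′ ≡ unbump x u ++ unbump x v
Θs-del⁻¹ (node cs ∷ ts) [] x v eq with ∷-injective eq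
... | refl , refl = cs ++ ts , here cs ts , Θs-del-here cs ts
Θs-del⁻¹ (node cs ∷ ts) (_ ∷ u) x v eq with ∷-injective eq
... | refl , eq′ with ++-split u (x ∷ v) (Θs cs) (shift (suc (size cs)) (Θs ts)) (sym eq′)
...   | inj₁ (_ , r , cs≡ , refl) with Θs-del⁻¹ cs u x r cs≡
...     | cs′ , d , cs′≡ = node cs′ ∷ ts , deep ts (inside d) ,
                           Θs-del-deep ts u x r (size-del d) (All.lookup (Θs-≤-size cs) (∈-middle cs≡)) cs′≡
Θs-del⁻¹ (node cs ∷ ts) (_ ∷ u) x v eq | refl , eq′ | inj₂ (r , refl , shift≡)
  with map-split (suc (size cs) +_) (Θs ts) r (x ∷ v) shift≡
... | _ , [] , _ , _ , ()
... | r₀ , x₀ ∷ v₀ , ts≡ , refl , refl with Θs-del⁻¹ ts r₀ x₀ v₀ ts≡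
...   | ts′ , d , ts′≡ = node cs ∷ ts′ , later (node cs) d , Θs-del-later cs r₀ x₀ v₀ ts′≡

-- Edge insertions are letter insertions

-- parent, leafˡ and leafʳ are (Λ → f), (Λ →l f) and (Λ →r f); pivot is the inserted letter
-- and core the word that replaces f.
data Kind : Set where
  parent leafˡ leafʳ : Kind

pivot : Kind → List ℕ → ℕ
pivot parent f = suc (maxL f)
pivot leafˡ  f = minL f
pivot leafʳ  f = suc (maxL f)

core : Kind → List ℕ → List ℕ
core parent f = pivot parent f ∷ f
core leafˡ  f = pivot leafˡ f ∷ bump (pivot leafˡ f) f
core leafʳ  f = f ++ pivot leafʳ f ∷ []

inserted : Kind → List ℕ → List ℕ → List ℕ → List ℕ
inserted k u f v = bump (pivot k f) u ++ core k f ++ bump (pivot k f) v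

data Insertion (w w′ : List ℕ) : Set where
  first     : w ≡ [] → w′ ≡ 1 ∷ [] → Insertion w w′
  insertion : ∀ k u f v → Complete f v → w ≡ u ++ f ++ v → w′ ≡ inserted k u f v → Insertion w w′

insR≡inserted : ∀ u f v → let a = suc (maxL f) in bump a u ++ f ++ a ∷ bump a v ≡ inserted leafʳ u f v
insR≡inserted u f v = cong (bump (suc (maxL f)) u ++_) (sym (++-assoc f (suc (maxL f) ∷ []) _))

Insertion⇔PermIns : ∀ {w w′} → Insertion w w′ ⇔ PermIns w w′
Insertion⇔PermIns = mk⇔ to from
  where
  to : ∀ {w w′} → Insertion w w′ → PermIns w w′
  to (first refl refl)                        = insEmpty
  to (insertion parent u f v c refl refl)     = ins u f v c
  to (insertion leafˡ  u f v c refl refl)     = insL u f v c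
  to (insertion leafʳ  u f v c refl refl)     = subst (PermIns _) (insR≡inserted u f v) (insR u f v c)
  from : ∀ {w w′} → PermIns w w′ → Insertion w w′
  from insEmpty       = first refl refl
  from (ins u f v c)  = insertion parent u f v c refl refl
  from (insL u f v c) = insertion leafˡ u f v c refl refl
  from (insR u f v c) = insertion leafʳ u f v c refl (insR≡inserted u f v)

pivot-shift : ∀ k a y ys → pivot k (shift a (y ∷ ys)) ≡ a + pivot k (y ∷ ys)
pivot-shift parent a y ys = trans (cong suc (maxL-shift a y ys)) (sym (+-suc a _))
pivot-shift leafˡ  a y ys = minL-shift a y ys
pivot-shift leafʳ  a y ys = trans (cong suc (maxL-shift a y ys)) (sym (+-suc a _))

core-shift : ∀ k a y ys → core k (shift a (y ∷ ys)) ≡ shift a (core k (y ∷ ys))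
core-shift parent a y ys = cong (_∷ shift a (y ∷ ys)) (pivot-shift parent a y ys)
core-shift leafˡ  a y ys = cong₂ _∷_ (pivot-shift leafˡ a y ys)
  (trans (cong (λ p → bump p (shift a (y ∷ ys))) (pivot-shift leafˡ a y ys)) (bump-shift a _ (y ∷ ys)))
core-shift leafʳ  a y ys =
  trans (cong (λ p → shift a (y ∷ ys) ++ p ∷ []) (pivot-shift leafʳ a y ys)) (sym (map-++ _ (y ∷ ys) _))

pivot-positive : ∀ k y ys → All (1 ≤_) (y ∷ ys) → 1 ≤ pivot k (y ∷ ys)
pivot-positive parent y ys _   = s≤s z≤n
pivot-positive leafˡ  y ys 1≤ = ≤-minL y ys 1≤
pivot-positive leafʳ  y ys _   = s≤s z≤n

pivot-≤ : ∀ k f {m} → f ≢ [] → All (_≤ m) f → pivot k f ≤ suc m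
pivot-≤ k      []       f≢[] _  = ⊥-elim (f≢[] refl)
pivot-≤ parent (y ∷ ys) _    f≤ = s≤s (maxL-≤ _ f≤)
pivot-≤ leafˡ  (y ∷ ys) _    f≤ = m≤n⇒m≤1+n (≤-trans (minL-≤ (y ∷ ys) (here refl)) (All.head f≤))
pivot-≤ leafʳ  (y ∷ ys) _    f≤ = s≤s (maxL-≤ _ f≤)

inserted-∷ : ∀ k a u f v W → pivot k f ≤ a →
  inserted k (a ∷ u) f (v ++ shift a W) ≡ suc a ∷ inserted k u f v ++ shift (suc a) W
inserted-∷ k a u f v W p≤a = cong₂ _∷_ (bump₁-≥ p≤a) (begin
  bump p u ++ core k f ++ bump p (v ++ shift a W)
      ≡⟨ cong (λ w → bump p u ++ core k f ++ w) (map-++ _ v _) ⟩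
  bump p u ++ core k f ++ bump p v ++ bump p (shift a W)
      ≡⟨ cong (λ w → bump p u ++ core k f ++ bump p v ++ w) (bump-shift-≥ a p≤W) ⟩
  bump p u ++ core k f ++ bump p v ++ shift (suc a) W
      ≡⟨ cong (bump p u ++_) (++-assoc (core k f) _ _) ⟨
  bump p u ++ (core k f ++ bump p v) ++ shift (suc a) W
      ≡⟨ ++-assoc (bump p u) _ _ ⟨
  (bump p u ++ core k f ++ bump p v) ++ shift (suc a) W ∎)
  where
  open ≡-Reasoning
  p = pivot k f
  p≤W : All (λ x → p ≤ a + x) W
  p≤W = All.universal (λ x → ≤-trans p≤a (m≤m+n a x)) W

inserted-shift : ∀ k a P u y ys v → All (1 ≤_) (y ∷ ys) → All (_≤ a) P →
  inserted k (P ++ shift a u) (shift a (y ∷ ys)) (shift a v) ≡ P ++ shift a (inserted k u (y ∷ ys) v)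
inserted-shift k a P u y ys v f-pos P≤a = begin
  bump (pivot k (shift a f)) (P ++ shift a u) ++ core k (shift a f) ++ bump (pivot k (shift a f)) (shift a v)
      ≡⟨ cong₂ (λ q c → bump q (P ++ shift a u) ++ c ++ bump q (shift a v))
               (pivot-shift k a y ys) (core-shift k a y ys) ⟩
  bump (a + p) (P ++ shift a u) ++ shift a (core k f) ++ bump (a + p) (shift a v)
      ≡⟨ cong (λ w → w ++ shift a (core k f) ++ bump (a + p) (shift a v)) (map-++ _ P _) ⟩
  (bump (a + p) P ++ bump (a + p) (shift a u)) ++ shift a (core k f) ++ bump (a + p) (shift a v)
      ≡⟨ cong₂ (λ w₁ w₂ → (w₁ ++ w₂) ++ shift a (core k f) ++ bump (a + p) (shift a v))
               (bump-< P<) (bump-shift a p u) ⟩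
  (P ++ shift a (bump p u)) ++ shift a (core k f) ++ bump (a + p) (shift a v)
      ≡⟨ cong (λ w → (P ++ shift a (bump p u)) ++ shift a (core k f) ++ w) (bump-shift a p v) ⟩
  (P ++ shift a (bump p u)) ++ shift a (core k f) ++ shift a (bump p v)
      ≡⟨ ++-assoc P _ _ ⟩
  P ++ shift a (bump p u) ++ shift a (core k f) ++ shift a (bump p v)
      ≡⟨ cong (λ w → P ++ shift a (bump p u) ++ w) (map-++ _ (core k f) _) ⟨
  P ++ shift a (bump p u) ++ shift a (core k f ++ bump p v)
      ≡⟨ cong (P ++_) (map-++ _ (bump p u) _) ⟨
  P ++ shift a (inserted k u f v) ∎
  where
  open ≡-Reasoning
  f = y ∷ ys
  p = pivot k f
  P< : All (_< a + p) P
  P< = All.map (λ x≤a → ≤-<-trans x≤a (m<m+n a (pivot-positive k y ys f-pos))) P≤a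

Θs-ins-parent : ∀ cs ts → Θs (node cs ∷ ts) ≡ inserted parent [] (Θs cs) (shift (size cs) (Θs ts))
Θs-ins-parent cs ts rewrite maxL-Θs cs =
  cong (λ w → suc (size cs) ∷ Θs cs ++ w)
       (sym (bump-shift-≥ (size cs) (All.map (m<m+n (size cs)) (Θs-positive ts))))

Θs-ins-leafʳ : ∀ ts₁ ts₂ → Θs (ts₁ ++ node [] ∷ ts₂) ≡ inserted leafʳ [] (Θs ts₁) (shift (size ts₁) (Θs ts₂))
Θs-ins-leafʳ ts₁ ts₂ rewrite maxL-Θs ts₁ = begin
  Θs (ts₁ ++ node [] ∷ ts₂)
      ≡⟨ Θs-++ ts₁ (node [] ∷ ts₂) ⟩
  Θs ts₁ ++ shift n (1 ∷ shift 1 W)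
      ≡⟨ cong (Θs ts₁ ++_) (cong₂ _∷_ (+-comm n 1) shift-suc) ⟩
  Θs ts₁ ++ suc n ∷ shift (suc n) W
      ≡⟨ cong (λ w → Θs ts₁ ++ suc n ∷ w) (bump-shift-≥ n (All.map (m<m+n n) (Θs-positive ts₂))) ⟨
  Θs ts₁ ++ suc n ∷ bump (suc n) (shift n W)
      ≡⟨ ++-assoc (Θs ts₁) _ _ ⟨
  (Θs ts₁ ++ suc n ∷ []) ++ bump (suc n) (shift n W) ∎
  where
  open ≡-Reasoning
  n = size ts₁
  W = Θs ts₂
  shift-suc : shift n (shift 1 W) ≡ shift (suc n) W
  shift-suc = trans (shift-shift n 1 W) (cong (λ k → shift k W) (+-comm n 1))

Θs-ins-leafˡ : ∀ cs ts₁ ts₂ → let ts = node cs ∷ ts₁ in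
  Θs (node [] ∷ ts ++ ts₂) ≡ inserted leafˡ [] (Θs ts) (shift (size ts) (Θs ts₂))
Θs-ins-leafˡ cs ts₁ ts₂ rewrite minL-Θs cs ts₁ = cong (1 ∷_) (begin
  shift 1 (Θs (ts ++ ts₂))                                 ≡⟨ bump-≥ (Θs-positive (ts ++ ts₂)) ⟨
  bump 1 (Θs (ts ++ ts₂))                                  ≡⟨ cong (bump 1) (Θs-++ ts ts₂) ⟩
  bump 1 (Θs ts ++ shift (size ts) (Θs ts₂))               ≡⟨ map-++ _ (Θs ts) _ ⟩
  bump 1 (Θs ts) ++ bump 1 (shift (size ts) (Θs ts₂)) ∎)
  where
  open ≡-Reasoning
  ts = node cs ∷ ts₁

Θs-ins-deep : ∀ k {cs cs′} ts u f v → size cs′ ≡ suc (size cs) → pivot k f ≤ suc (size cs) →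
  Θs cs′ ≡ inserted k u f v →
  Θs (node cs′ ∷ ts) ≡ inserted k (suc (size cs) ∷ u) f (v ++ shift (suc (size cs)) (Θs ts))
Θs-ins-deep k ts u f v size≡ p≤ eq rewrite size≡ | eq = sym (inserted-∷ k _ u f v (Θs ts) p≤)

Θs-ins-later : ∀ k cs {ts′} u f v → f ≢ [] → All (1 ≤_) f → Θs ts′ ≡ inserted k u f v →
  let a = suc (size cs) in Θs (node cs ∷ ts′) ≡ inserted k (a ∷ Θs cs ++ shift a u) (shift a f) (shift a v)
Θs-ins-later k cs u []       v f≢[] _     _  = ⊥-elim (f≢[] refl)
Θs-ins-later k cs u (y ∷ ys) v _    f-pos eq rewrite eq =
  sym (inserted-shift k _ (_ ∷ Θs cs) u y ys v f-pos (≤-refl ∷ All.map m≤n⇒m≤1+n (Θs-≤-size cs)))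

Θs-ins : ∀ {ts′ ts} → DelF ts′ ts → Insertion (Θs ts) (Θs ts′)
Θs-ins (here [] [])             = first refl refl
Θs-ins (here [] (node c ∷ ts))  =
  insertion leafˡ [] _ _ (Θs-complete c [] ts) (Θs-++ (node c ∷ []) ts) (Θs-ins-leafˡ c [] ts)
Θs-ins (here (node c ∷ cs) ts)  =
  insertion parent [] _ _ (Θs-complete c cs ts) (Θs-++ (node c ∷ cs) ts) (Θs-ins-parent (node c ∷ cs) ts)
Θs-ins (deep ts (inside {big} {cs} d)) with Θs-ins d
... | first cs≡[] big≡
      with refl ← Θs≡[] cs≡[] | refl ← Θs-injective big (node [] ∷ []) big≡ =
  insertion parent [] (1 ∷ []) _ (Θs-complete [] [] ts) refl (Θs-ins-parent (node [] ∷ []) ts)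
... | insertion k u f v c cs≡ big≡ =
  insertion k (a ∷ u) f (v ++ M) (complete-++⁺ f v M c M-above) word
    (Θs-ins-deep k ts u f v (size-del d) (pivot-≤ k f (proj₁ (proj₁ c)) f≤) big≡)
  where
  a = suc (size cs)
  M = shift a (Θs ts)
  f≤ : All (_≤ size cs) f
  f≤ = All.++⁻ˡ f (All.++⁻ʳ u (subst (All (_≤ size cs)) cs≡ (Θs-≤-size cs)))
  M-above : All (maxL f <_) M
  M-above = All.map (<-trans (s≤s (maxL-≤ f f≤))) (Θs-shift-> a ts)
  word : a ∷ Θs cs ++ M ≡ (a ∷ u) ++ f ++ v ++ M
  word = cong (a ∷_) (trans (cong (_++ M) cs≡)
                            (trans (++-assoc u (f ++ v) M) (cong (u ++_) (++-assoc f v M))))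
Θs-ins (later (node cs) {ts′} {ts} d) with Θs-ins d
... | first ts≡[] ts′≡
      with refl ← Θs≡[] ts≡[] | refl ← Θs-injective ts′ (node [] ∷ []) ts′≡ =
  insertion leafʳ [] _ [] (Θs-complete cs [] []) (sym (++-identityʳ _)) (Θs-ins-leafʳ (node cs ∷ []) [])
... | insertion k u f v c ts≡ ts′≡ =
  insertion k (a ∷ Θs cs ++ shift a u) (shift a f) (shift a v) (complete-shift⁺ a f v c) word
    (Θs-ins-later k cs u f v (proj₁ (proj₁ c)) f-pos ts′≡)
  where
  a = suc (size cs)
  f-pos : All (1 ≤_) f
  f-pos = All.++⁻ˡ f (All.++⁻ʳ u (subst (All (1 ≤_)) ts≡ (Θs-positive ts)))
  word : a ∷ Θs cs ++ shift a (Θs ts) ≡ (a ∷ Θs cs ++ shift a u) ++ shift a f ++ shift a v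
  word = cong (a ∷_) (trans (cong (λ w → Θs cs ++ shift a w) ts≡)
    (trans (cong (Θs cs ++_) (trans (map-++ _ u _) (cong (shift a u ++_) (map-++ _ f v))))
           (sym (++-assoc (Θs cs) _ _))))

Θs-prefix : ∀ ts p q m → Θs ts ≡ p ++ q → All (_≤ m) p → (∀ {x} → 1 ≤ x → x ≤ m → x ∈ p) →
  ∃[ ts₁ ] ∃[ ts₂ ] ts ≡ ts₁ ++ ts₂ × p ≡ Θs ts₁
Θs-prefix []             []      _ _ _  _   _     = [] , [] , refl , refl
Θs-prefix (node cs ∷ ts) []      _ _ _  _   _     = [] , node cs ∷ ts , refl , refl
Θs-prefix (node cs ∷ ts) (_ ∷ p) q m eq (a≤m ∷ p≤m) covers with ∷-injective eq
... | refl , eq′ with ++-split p q (Θs cs) (shift (suc (size cs)) (Θs ts)) (sym eq′)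
  -- p would stop inside the first tree, missing one of its letters z ≤ size cs < m.
...   | inj₁ (z , r , cs≡ , _) = ⊥-elim (z∉ (covers 1≤z (≤-trans z≤ (≤-trans (n≤1+n _) a≤m))))
  where
  1≤z : 1 ≤ z
  1≤z = proj₁ (All.lookup (Θs-bounded cs) (∈-middle cs≡))
  z≤ : z ≤ size cs
  z≤ = proj₂ (All.lookup (Θs-bounded cs) (∈-middle cs≡))
  z∉ : z ∉ suc (size cs) ∷ p
  z∉ (here z≡a)  = 1+n≰n (subst (_≤ size cs) z≡a z≤)
  z∉ (there z∈p) = ∉-before-unique p r (subst Unique cs≡ (Θs-unique cs)) z∈p
...   | inj₂ (r , refl , shift≡) with map-split (suc (size cs) +_) (Θs ts) r q shift≡ | m≤n⇒∃[o]m+o≡n a≤m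
...     | r₀ , q₀ , ts≡ , refl , refl | m′ , refl with Θs-prefix ts r₀ q₀ m′ ts≡ r₀≤m′ r₀-covers
  where
  a = suc (size cs)
  r₀≤m′ : All (_≤ m′) r₀
  r₀≤m′ = All.map (+-cancelˡ-≤ a _ _) (All.map⁻ (All.++⁻ʳ (Θs cs) p≤m))
  r₀-covers : ∀ {y} → 1 ≤ y → y ≤ m′ → y ∈ r₀
  r₀-covers {y} 1≤y y≤m′ with covers (≤-trans 1≤y (m≤n+m y a)) (+-monoʳ-≤ a y≤m′)
  ... | here a+y≡a = ⊥-elim (<⇒≢ (m<m+n a 1≤y) (sym a+y≡a))
  ... | there a+y∈ with ∈-++⁻ (Θs cs) a+y∈
  ...   | inj₁ a+y∈cs = ⊥-elim (<⇒≱ (s≤s (m≤m+n (size cs) y)) (All.lookup (Θs-≤-size cs) a+y∈cs))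
  ...   | inj₂ a+y∈r  = ∈-shift⁻ a r₀ a+y∈r
...       | ts₁ , ts₂ , refl , refl = node cs ∷ ts₁ , ts₂ , refl , refl

complete-prefix-∋1 : ∀ ts f v → Complete f v → Θs ts ≡ f ++ v → 1 ∈ f
complete-prefix-∋1 ts []                v ((f≢[] , _) , _) _  = ⊥-elim (f≢[] refl)
complete-prefix-∋1 (node cs ∷ ts) (_ ∷ f) v (_ , maximal)   eq with ∷-injective eq
... | refl , eq′ with ++-split f v (Θs cs) (shift (suc (size cs)) (Θs ts)) (sym eq′)
  -- f cannot end inside the first tree: the rest of that tree would extend it compactly
  -- with the same maximum.
...   | inj₁ (z , r , cs≡ , v≡) = ⊥-elim (maximal (z ∷ r) _ v≡ (λ ()) compact max≡)
  where
  a = suc (size cs)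
  cs≡′ : Θs cs ++ [] ≡ f ++ z ∷ r
  cs≡′ = trans (++-identityʳ _) cs≡
  compact : Compact (a ∷ f ++ z ∷ r)
  compact = subst Compact (cong (a ∷_) cs≡′) (Θs-compact cs [])
  f++zr≤a : All (_≤ a) (f ++ z ∷ r)
  f++zr≤a = subst (All (_≤ a)) cs≡ (All.map m≤n⇒m≤1+n (Θs-≤-size cs))
  max≡ : maxL (a ∷ f ++ z ∷ r) ≡ maxL (a ∷ f)
  max≡ = trans (maxL-∷-≥ _ f++zr≤a) (sym (maxL-∷-≥ f (All.++⁻ˡ f f++zr≤a)))
...   | inj₂ (r , refl , _) with ∈-Θs (node cs ∷ []) ≤-refl (s≤s z≤n)
...     | here 1≡a    = here 1≡a
...     | there 1∈cs = there (∈-++⁺ˡ (subst (1 ∈_) (++-identityʳ _) 1∈cs))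

complete-prefix-covers : ∀ ts f v → Complete f v → Θs ts ≡ f ++ v → ∀ {x} → 1 ≤ x → x ≤ maxL f → x ∈ f
complete-prefix-covers ts []       v ((f≢[] , _) , _)          _  _   _    = ⊥-elim (f≢[] refl)
complete-prefix-covers ts (y ∷ ys) v c@((_ , interval) , _) eq {x} 1≤x x≤max =
  Equivalence.from (interval x) (subst (_≤ x) (sym minL≡1) 1≤x , x≤max)
  where
  minL≡1 : minL (y ∷ ys) ≡ 1
  minL≡1 = ≤-antisym (minL-≤ _ (complete-prefix-∋1 ts _ v c eq))
                     (≤-minL y ys (All.++⁻ˡ (y ∷ ys) (subst (All (1 ≤_)) eq (Θs-positive ts))))

InsertedForest : Kind → List Tree → List ℕ → List ℕ → List ℕ → Set
InsertedForest k ts u f v = ∃[ ts′ ] DelF ts′ ts × Θs ts′ ≡ inserted k u f v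

insert-first-trees : ∀ k cs ts₁ ts₂ → let ts = node cs ∷ ts₁ in
  InsertedForest k (ts ++ ts₂) [] (Θs ts) (shift (size ts) (Θs ts₂))
insert-first-trees parent cs ts₁ ts₂ =
  node (node cs ∷ ts₁) ∷ ts₂ , here _ ts₂ , Θs-ins-parent (node cs ∷ ts₁) ts₂
insert-first-trees leafˡ  cs ts₁ ts₂ = node [] ∷ _ , here [] _ , Θs-ins-leafˡ cs ts₁ ts₂
insert-first-trees leafʳ  cs ts₁ ts₂ =
  (node cs ∷ ts₁) ++ node [] ∷ ts₂ , DelF-++ˡ (node cs ∷ ts₁) (here [] ts₂) , Θs-ins-leafʳ (node cs ∷ ts₁) ts₂

Θs-ins⁻¹-first : ∀ k ts f v → Complete f v → Θs ts ≡ f ++ v → InsertedForest k ts [] f v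
Θs-ins⁻¹-first k ts f v c eq
  with Θs-prefix ts f v (maxL f) eq (All.tabulate (≤-maxL f)) (complete-prefix-covers ts f v c eq)
... | [] , _ , _ , refl = ⊥-elim (proj₁ (proj₁ c) refl)
... | node cs ∷ ts₁ , ts₂ , refl , refl
      with refl ← proj₂ (++-cancel-length (Θs (node cs ∷ ts₁)) _ _ v
                                           (trans (sym (Θs-++ (node cs ∷ ts₁) ts₂)) eq) refl) =
  insert-first-trees k cs ts₁ ts₂

Θs-ins⁻¹ : ∀ k ts u f v → Complete f v → Θs ts ≡ u ++ f ++ v → InsertedForest k ts u f v
Θs-ins⁻¹ k ts             []      f v c eq = Θs-ins⁻¹-first k ts f v c eq
Θs-ins⁻¹ k (node cs ∷ ts) (_ ∷ u) f v c eq with ∷-injective eq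
... | refl , eq′ with ++-split u (f ++ v) (Θs cs) (shift (suc (size cs)) (Θs ts)) (sym eq′)
...   | inj₁ (z , r , cs≡ , fv≡) with ++-split (z ∷ r) (shift (suc (size cs)) (Θs ts)) f v (sym fv≡)
    -- f cannot straddle the first tree and the later ones: being compact, it would contain
    -- their root label.
...     | inj₁ (y , s , refl , s≡) = ⊥-elim (compact-no-gap r s zr<a a<ys (proj₁ c))
  where
  a = suc (size cs)
  zr<a : All (_< a) (z ∷ r)
  zr<a = All.map s≤s (All.++⁻ʳ u (subst (All (_≤ size cs)) cs≡ (Θs-≤-size cs)))
  a<ys : All (a <_) (y ∷ s)
  a<ys = All.++⁻ˡ (y ∷ s) (subst (All (a <_)) s≡ (Θs-shift-> a ts))
...     | inj₂ (v₁ , zr≡ , refl) with cs≡′ ← trans cs≡ (cong (u ++_) zr≡)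
                                 with Θs-ins⁻¹ k cs u f v₁ (complete-++⁻ f v₁ _ c) cs≡′
...       | cs′ , d , cs′≡ = node cs′ ∷ ts , deep ts (inside d) ,
  Θs-ins-deep k ts u f v₁ (size-del d) (pivot-≤ k f (proj₁ (proj₁ c)) f≤) cs′≡
  where
  f≤ : All (_≤ size cs) f
  f≤ = All.++⁻ˡ f (All.++⁻ʳ u (subst (All (_≤ size cs)) cs≡′ (Θs-≤-size cs)))
Θs-ins⁻¹ k (node cs ∷ ts) (_ ∷ u) f v c eq | refl , eq′ | inj₂ (r , refl , shift≡)
  with map-split (suc (size cs) +_) (Θs ts) r (f ++ v) shift≡
... | r₀ , fv₀ , ts≡ , refl , fv≡ with map-split (suc (size cs) +_) fv₀ f v (sym fv≡)
...   | f₀ , v₀ , refl , refl , refl with c₀ ← complete-shift⁻ (suc (size cs)) f₀ v₀ c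
                                   with Θs-ins⁻¹ k ts r₀ f₀ v₀ c₀ ts≡
...     | ts′ , d , ts′≡ = node cs ∷ ts′ , later (node cs) d ,
  Θs-ins-later k cs r₀ f₀ v₀ (proj₁ (proj₁ c₀)) f₀-pos ts′≡
  where
  f₀-pos : All (1 ≤_) f₀
  f₀-pos = All.++⁻ˡ f₀ (All.++⁻ʳ r₀ (subst (All (1 ≤_)) ts≡ (Θs-positive ts)))

Θ-injective : ∀ {T T′} → Θ T ≡ Θ T′ → T ≡ T′
Θ-injective {node cs} {node cs′} eq rewrite Θ≡Θs cs | Θ≡Θs cs′ = cong node (Θs-injective cs cs′ eq)

Θ-edit : ∀ {T T′} → TreeEdit T T′ → PermEdit (Θ T) (Θ T′)
Θ-edit (inj₁ (inside {cs} {cs′} d)) rewrite Θ≡Θs cs | Θ≡Θs cs′ =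
  inj₁ (Equivalence.to Deletion⇔PermDel (Θs-del d))
Θ-edit (inj₂ (inside {cs} {cs′} d)) rewrite Θ≡Θs cs | Θ≡Θs cs′ =
  inj₂ (Equivalence.to Insertion⇔PermIns (Θs-ins d))

Θ-lift : ∀ {T σ} → PermEdit (Θ T) σ → ∃[ T′ ] TreeEdit T T′ × Θ T′ ≡ σ
Θ-lift {node cs} e rewrite Θ≡Θs cs with e
... | inj₁ δ with Equivalence.from Deletion⇔PermDel δ
...   | deletion u x v cs≡ σ≡ with Θs-del⁻¹ cs u x v cs≡
...     | cs′ , d , cs′≡ = node cs′ , inj₁ (inside d) , trans (Θ≡Θs cs′) (trans cs′≡ (sym σ≡))
Θ-lift {node cs} e | inj₂ ι with Equivalence.from Insertion⇔PermIns ι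
...   | first cs≡[] σ≡ with refl ← Θs≡[] cs≡[] = node (node [] ∷ []) , inj₂ (inside (here [] [])) , sym σ≡
...   | insertion k u f v c cs≡ σ≡ with Θs-ins⁻¹ k cs u f v c cs≡
...     | cs′ , d , cs′≡ = node cs′ , inj₂ (inside d) , trans (Θ≡Θs cs′) (trans cs′≡ (sym σ≡))

mainTheorem4 : (T₁ T₂ : Tree) (n : ℕ) →
    TreeEditDist T₁ T₂ n ⇔ PermDist (Θ T₁) (Θ T₂) n
mainTheorem4 T₁ T₂ n = IsDist-transport Θ Θ-injective Θ-edit Θ-lift
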